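{- Let $R$ be a commutative ring with unity and let $G$ be a connected graph with edge labeling $\alpha$ over $R$ and a bridge $ab$ labeled by a principal ideal $\alpha(ab)=(\beta)$. Suppose $G-\{ab\}$ has two components, $A$ containing $a$ and $B$ containing $b$ (each with the restricted labeling). Let $\mathbbm{1}_B$ be the function on the vertices of $G$ which is $1$ on the vertices of $B$ and $0$ on the vertices of $A$. Then $$S(G)\cong S(A;a)\oplus S(B;b)\oplus\langle\mathbbm{1}_G\rangle\oplus\langle\beta\mathbbm{1}_B\rangle.$$
   Context: An edge labeling of a graph $G=(V,E)$ over $R$ is a function $\alpha:E\to I(R)$ to the set of ideals of $R$. A spline on $(G,\alpha)$ is a function $p:V\to R$ with $p(u)-p(v)\in\alpha(uv)$ for every edge $uv$; $S(G)$ is the ring/$R$-module of splines. For a vertex $v$ of a labeled graph $K$, $S(K;v)$ is the set of splines $p$ on $K$ with $p(v)=0$. $\mathbbm{1}_G$ is the constant spline with value $1$; $\langle x\rangle$ denotes the $R$-submodule generated by $x$. A bridge is an edge whose deletion disconnects the graph. -}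

module Defs where

open import Level using (Level; _⊔_; suc)
open import Data.Nat using (ℕ)
open import Data.Fin using (Fin)
open import Data.Product using (Σ; ∃; _×_; _,_; proj₁; proj₂)
open import Data.Sum using (_⊎_)
open import Data.Unit.Polymorphic using (⊤)
open import Relation.Nullary using (¬_)
open import Relation.Binary.PropositionalEquality using (_≡_; _≢_)
open import Algebra.Bundles using (CommutativeRing)
open import Algebra.Module.Bundles.Raw using (RawLeftModule)
import Algebra.Module.Construct.DirectProduct as DP
import Tactic.RingSolver.Core.AlmostCommutativeRing as ACR
open import Data.Maybe using (nothing)
import Tactic.RingSolver.NonReflective as NonRefl
import Algebra.Properties.Ring as RingProps
import Algebra.Properties.AbelianGroup as AGProps

record Ideal {c ℓ} (R : CommutativeRing c ℓ) (i : Level) : Set (c ⊔ ℓ ⊔ suc i) where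
  open CommutativeRing R
  field
    _∈I   : Carrier → Set i
    ∈-resp : ∀ {x y} → x ≈ y → x ∈I → y ∈I
    0∈     : 0# ∈I
    +-∈    : ∀ {x y} → x ∈I → y ∈I → (x + y) ∈I
    *-∈    : ∀ r {x} → x ∈I → (r * x) ∈I

IsPrincipalBy : ∀ {c ℓ i} (R : CommutativeRing c ℓ) → Ideal R i → CommutativeRing.Carrier R → Set (c ⊔ ℓ ⊔ i)
IsPrincipalBy R I β = ∀ x → (x ∈I → ∃ λ r → x ≈ r * β) × ((∃ λ r → x ≈ r * β) → x ∈I)
  where open CommutativeRing R
        open Ideal I

record SimpleGraph : Set where
  field
    n m       : ℕ
    src tgt   : Fin m → Fin n
    loopless  : ∀ e → src e ≢ tgt e
    noMulti   : ∀ e e′ → ((src e ≡ src e′ × tgt e ≡ tgt e′) ⊎ (src e ≡ tgt e′ × tgt e ≡ src e′)) → e ≡ e′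

module GraphNotions (G : SimpleGraph) where
  open SimpleGraph G public

  Joins : Fin m → Fin n → Fin n → Set
  Joins e u v = (src e ≡ u × tgt e ≡ v) ⊎ (src e ≡ v × tgt e ≡ u)

  data Reach (P : Fin m → Set) : Fin n → Fin n → Set where
    here : ∀ {v} → Reach P v v
    step : ∀ {u v w} e → P e → Joins e u v → Reach P v w → Reach P u w

  Connected : (Fin m → Set) → Set
  Connected P = ∀ u v → Reach P u v

  allEdges : Fin m → Set
  allEdges _ = ⊤

  without : Fin m → Fin m → Set
  without e₀ e = e ≢ e₀

  IsBridge : Fin m → Set
  IsBridge e₀ = ¬ Connected (without e₀)

module Splines {c ℓ i} (R : CommutativeRing c ℓ) (G : SimpleGraph)
               (α : Fin (SimpleGraph.m G) → Ideal R i) (e₀ : Fin (SimpleGraph.m G)) where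
  open CommutativeRing R
  open GraphNotions G
  private
    Rᴬ : ACR.AlmostCommutativeRing c ℓ
    Rᴬ = ACR.fromCommutativeRing R (λ _ → nothing)
    module NR = NonRefl Rᴬ
    open NR using (_⊕_; _⊗_; ⊝_; Κ; _⊜_)
    module RP = RingProps ring
    module AGP = AGProps +-abelianGroup
  private
    _∈_ : Carrier → Fin m → Set i
    x ∈ e = Ideal._∈I (α e) x

  a b : Fin n
  a = src e₀
  b = tgt e₀

  InA InB : Fin n → Set
  InA v = Reach (without e₀) a v
  InB v = Reach (without e₀) b v

  IsSpline : (Fin n → Carrier) → Set i
  IsSpline p = ∀ e → (p (src e) - p (tgt e)) ∈ e

  IsSplineOnVanishing : (Fin n → Set) → Fin n → (Fin n → Carrier) → Set (i ⊔ ℓ)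
  IsSplineOnVanishing C z p =
    (∀ e → e ≢ e₀ → C (src e) → C (tgt e) → (p (src e) - p (tgt e)) ∈ e) × (p z ≈ 0#)

  private
    lem+ : ∀ x y z w → (x + y) - (z + w) ≈ (x - z) + (y - w)
    lem+ = NR.solve 4 (λ x y z w → ((x ⊕ y) ⊕ (⊝ (z ⊕ w))) ⊜ ((x ⊕ (⊝ z)) ⊕ (y ⊕ (⊝ w)))) refl
    lem* : ∀ r x y → r * x - r * y ≈ r * (x - y)
    lem* r x y = sym (RP.x[y-z]≈xy-xz r x y)
    lem- : ∀ x y → (- x) - (- y) ≈ (- 1#) * (x - y)
    lem- x y = trans (AGP.⁻¹-∙-comm x (- y)) (sym (RP.-1*x≈-x _))
    lem0 : 0# * 0# ≈ 0# - 0#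
    lem0 = trans (zeroˡ 0#) (sym (-‿inverseʳ 0#))
    lemr+ : ∀ x y r s → x ≈ r → y ≈ s → x + y ≈ r + s
    lemr+ x y r s p q = +-cong p q
    lemb+ : ∀ r s β → r * β + s * β ≈ (r + s) * β
    lemb+ r s β = sym (distribʳ β r s)
    lembn : ∀ r β → - (r * β) ≈ (- r) * β
    lembn r β = RP.-‿distribˡ-* r β
    lemb* : ∀ t r β → t * (r * β) ≈ (t * r) * β
    lemb* t r β = sym (*-assoc t r β)
    lem00 : ∀ t → t * 0# ≈ 0#
    lem00 = zeroʳ
    lemn0 : - 0# ≈ 0#
    lemn0 = trans (sym (+-identityˡ (- 0#))) (-‿inverseʳ 0#)
    lem000 : 0# + 0# ≈ 0#
    lem000 = +-identityˡ 0#
    lem0b : 0# ≈ 0# * 0#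
    lem0b = sym (zeroˡ 0#)

    +∈ : ∀ {e} (p q : Fin n → Carrier) → (p (src e) - p (tgt e)) ∈ e → (q (src e) - q (tgt e)) ∈ e →
         ((p (src e) + q (src e)) - (p (tgt e) + q (tgt e))) ∈ e
    +∈ {e} p q x y = Ideal.∈-resp (α e) (sym (lem+ (p (src e)) (q (src e)) (p (tgt e)) (q (tgt e)))) (Ideal.+-∈ (α e) x y)
    *∈ : ∀ {e} r (p : Fin n → Carrier) → (p (src e) - p (tgt e)) ∈ e → (r * p (src e) - r * p (tgt e)) ∈ e
    *∈ {e} r p x = Ideal.∈-resp (α e) (sym (lem* r (p (src e)) (p (tgt e)))) (Ideal.*-∈ (α e) r x)
    -∈ : ∀ {e} (p : Fin n → Carrier) → (p (src e) - p (tgt e)) ∈ e → ((- p (src e)) - (- p (tgt e))) ∈ e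
    -∈ {e} p x = Ideal.∈-resp (α e) (sym (lem- (p (src e)) (p (tgt e)))) (Ideal.*-∈ (α e) (- 1#) x)
    0∈ : ∀ {e} → (0# - 0#) ∈ e
    0∈ {e} = Ideal.∈-resp (α e) lem0 (Ideal.*-∈ (α e) 0# (Ideal.0∈ (α e)))

  S-G : RawLeftModule Carrier (c ⊔ i) ℓ
  S-G = record
    { Carrierᴹ = Σ (Fin n → Carrier) IsSpline
    ; _≈ᴹ_ = λ p q → ∀ v → proj₁ p v ≈ proj₁ q v
    ; _+ᴹ_ = λ p q → (λ v → proj₁ p v + proj₁ q v) , λ e → +∈ (proj₁ p) (proj₁ q) (proj₂ p e) (proj₂ q e)
    ; _*ₗ_ = λ r p → (λ v → r * proj₁ p v) , λ e → *∈ r (proj₁ p) (proj₂ p e)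
    ; 0ᴹ  = (λ _ → 0#) , λ e → 0∈
    ; -ᴹ_ = λ p → (λ v → - proj₁ p v) , λ e → -∈ (proj₁ p) (proj₂ p e)
    }

  -- S(C;z) for a component C of G - ab: functions on the vertices of C,
  -- represented as functions on all vertices compared only on C.
  S-comp : (Fin n → Set) → Fin n → RawLeftModule Carrier (c ⊔ i ⊔ ℓ) ℓ
  S-comp C z = record
    { Carrierᴹ = Σ (Fin n → Carrier) (IsSplineOnVanishing C z)
    ; _≈ᴹ_ = λ p q → ∀ v → C v → proj₁ p v ≈ proj₁ q v
    ; _+ᴹ_ = λ p q → (λ v → proj₁ p v + proj₁ q v)
                   , (λ e ne cs ct → +∈ (proj₁ p) (proj₁ q) (proj₁ (proj₂ p) e ne cs ct) (proj₁ (proj₂ q) e ne cs ct))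
                   , trans (+-cong (proj₂ (proj₂ p)) (proj₂ (proj₂ q))) lem000
    ; _*ₗ_ = λ r p → (λ v → r * proj₁ p v)
                   , (λ e ne cs ct → *∈ r (proj₁ p) (proj₁ (proj₂ p) e ne cs ct))
                   , trans (*-cong refl (proj₂ (proj₂ p))) (lem00 r)
    ; 0ᴹ  = (λ _ → 0#) , (λ e _ _ _ → 0∈) , refl
    ; -ᴹ_ = λ p → (λ v → - proj₁ p v)
                , (λ e ne cs ct → -∈ (proj₁ p) (proj₁ (proj₂ p) e ne cs ct))
                , trans (-‿cong (proj₂ (proj₂ p))) lemn0
    }

  S-A-a S-B-b : RawLeftModule Carrier (c ⊔ i ⊔ ℓ) ℓ
  S-A-a = S-comp InA a
  S-B-b = S-comp InB b

  Gen𝟙G : RawLeftModule Carrier (c ⊔ ℓ) ℓ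
  Gen𝟙G = record
    { Carrierᴹ = Σ (Fin n → Carrier) (λ y → ∃ λ r → ∀ v → y v ≈ r * 1#)
    ; _≈ᴹ_ = λ p q → ∀ v → proj₁ p v ≈ proj₁ q v
    ; _+ᴹ_ = λ p q → (λ v → proj₁ p v + proj₁ q v)
                   , (proj₁ (proj₂ p) + proj₁ (proj₂ q))
                   , λ v → trans (+-cong (proj₂ (proj₂ p) v) (proj₂ (proj₂ q) v)) (lemb+ _ _ _)
    ; _*ₗ_ = λ t p → (λ v → t * proj₁ p v)
                   , (t * proj₁ (proj₂ p))
                   , λ v → trans (*-cong refl (proj₂ (proj₂ p) v)) (lemb* _ _ _)
    ; 0ᴹ  = (λ _ → 0#) , 0# , λ v → lem0b′
    ; -ᴹ_ = λ p → (λ v → - proj₁ p v) , (- proj₁ (proj₂ p))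
                , λ v → trans (-‿cong (proj₂ (proj₂ p) v)) (lembn _ _)
    }
    where
      lem0b′ : 0# ≈ 0# * 1#
      lem0b′ = sym (zeroˡ 1#)

  Genβ𝟙B : Carrier → RawLeftModule Carrier (c ⊔ ℓ) ℓ
  Genβ𝟙B β = record
    { Carrierᴹ = Σ (Fin n → Carrier) (λ y → ∃ λ r →
                   (∀ v → InB v → y v ≈ r * (β * 1#)) × (∀ v → InA v → y v ≈ r * (β * 0#)))
    ; _≈ᴹ_ = λ p q → ∀ v → proj₁ p v ≈ proj₁ q v
    ; _+ᴹ_ = λ p q → (λ v → proj₁ p v + proj₁ q v)
                   , (proj₁ (proj₂ p) + proj₁ (proj₂ q))
                   , (λ v h → trans (+-cong (proj₁ (proj₂ (proj₂ p)) v h) (proj₁ (proj₂ (proj₂ q)) v h)) (lemb+ _ _ _))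
                   , (λ v h → trans (+-cong (proj₂ (proj₂ (proj₂ p)) v h) (proj₂ (proj₂ (proj₂ q)) v h)) (lemb+ _ _ _))
    ; _*ₗ_ = λ t p → (λ v → t * proj₁ p v)
                   , (t * proj₁ (proj₂ p))
                   , (λ v h → trans (*-cong refl (proj₁ (proj₂ (proj₂ p)) v h)) (lemb* _ _ _))
                   , (λ v h → trans (*-cong refl (proj₂ (proj₂ (proj₂ p)) v h)) (lemb* _ _ _))
    ; 0ᴹ  = (λ _ → 0#) , 0# , (λ v _ → lz _) , (λ v _ → lz _)
    ; -ᴹ_ = λ p → (λ v → - proj₁ p v) , (- proj₁ (proj₂ p))
                , (λ v h → trans (-‿cong (proj₁ (proj₂ (proj₂ p)) v h)) (lembn _ _))
                , (λ v h → trans (-‿cong (proj₂ (proj₂ (proj₂ p)) v h)) (lembn _ _))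
    }
    where
      lz : ∀ x → 0# ≈ 0# * x
      lz x = sym (zeroˡ x)

  DirectSum : Carrier → RawLeftModule Carrier (c ⊔ i ⊔ ℓ) ℓ
  DirectSum β = DP.rawLeftModule S-A-a (DP.rawLeftModule S-B-b (DP.rawLeftModule Gen𝟙G (Genβ𝟙B β)))

-- Deleting the bridge ab leaves two components, so every vertex lies on exactly one
-- side. A spline p is recorded by p − p(a) on A, p − p(b) on B, the constant p(a),
-- and the jump p(b) − p(a) placed on B; the jump lies in (β) because ab is labelled
-- by (β). Conversely the four pieces glue to the spline which is κ + q_A on A and
-- κ + rβ + q_B on B: edges of A or B see only q_A or q_B, and the bridge sees −rβ.
module Submission where

open import Defs
open import Function using (id; _∘_)
open import Data.Fin using (Fin; _≟_)
open import Data.Product using (∃; _×_; _,_; proj₁; proj₂)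
open import Data.Sum using (_⊎_; inj₁; inj₂; [_,_]′; swap)
import Data.Sum as Sum
open import Data.Empty using (⊥; ⊥-elim)
open import Relation.Nullary using (yes; no)
open import Relation.Binary.PropositionalEquality using (_≡_; _≢_)
import Relation.Binary.PropositionalEquality as ≡
open import Algebra.Bundles using (CommutativeRing)
open import Algebra.Module.Bundles.Raw using (RawLeftModule)
open import Algebra.Module.Morphism.Structures using (module LeftModuleMorphisms)
open import Data.Maybe using (nothing)
import Tactic.RingSolver.Core.AlmostCommutativeRing as ACR
import Tactic.RingSolver.NonReflective as NonReflective
import Relation.Binary.Reasoning.Setoid as SetoidReasoning
import Algebra.Properties.Ring as RingProperties
import Algebra.Properties.AbelianGroup as AbelianGroupProperties
import Algebra.Properties.CommutativeSemigroup as CommutativeSemigroupProperties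

module Walks (G : SimpleGraph) where
  open GraphNotions G

  private
    variable
      P : Fin m → Set
      u v w : Fin n

  Joins-sym : ∀ {e} → Joins e u v → Joins e v u
  Joins-sym = swap

  _◅◅_ : Reach P u v → Reach P v w → Reach P u w
  here ◅◅ s = s
  step e pe j r ◅◅ s = step e pe j (r ◅◅ s)

  snoc : Reach P u v → ∀ e → P e → Joins e v w → Reach P u w
  snoc r e pe j = r ◅◅ step e pe j here

  reverse : Reach P u v → Reach P v u
  reverse r = reverse-onto r here
    where
      reverse-onto : ∀ {P u v w} → Reach P u v → Reach P u w → Reach P v w
      reverse-onto here acc = acc
      reverse-onto (step e pe j r) acc = reverse-onto r (step e pe (Joins-sym j) acc)

module BridgeSides (G : SimpleGraph) (e₀ : Fin (SimpleGraph.m G)) where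
  open GraphNotions G
  open Walks G

  private
    variable
      u v w : Fin n

  a b : Fin n
  a = src e₀
  b = tgt e₀

  InA InB Side : Fin n → Set
  InA = Reach (without e₀) a
  InB = Reach (without e₀) b
  Side v = InA v ⊎ InB v

  extend-side : ∀ {e} → e ≢ e₀ → Joins e u w → Side u → Side w
  extend-side {e = e} e≢e₀ j = Sum.map (λ h → snoc h e e≢e₀ j) (λ h → snoc h e e≢e₀ j)

  endpoint-side : Joins e₀ u w → Side w
  endpoint-side (inj₁ (_ , ≡.refl)) = inj₂ here
  endpoint-side (inj₂ (≡.refl , _)) = inj₁ here

  side-along : Reach allEdges u v → Side u → Side v
  side-along here s = s
  side-along (step e _ j r) s with e ≟ e₀
  ... | yes ≡.refl = side-along r (endpoint-side j)
  ... | no e≢e₀ = side-along r (extend-side e≢e₀ j s)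

  module Components (connected : Connected allEdges) where
    side : ∀ v → Side v
    side v = side-along (connected a v) (inj₁ here)

    edge-within-side : ∀ {e} → e ≢ e₀ →
                       (InA (src e) × InA (tgt e)) ⊎ (InB (src e) × InB (tgt e))
    edge-within-side {e} e≢e₀ with side (src e)
    ... | inj₁ h = inj₁ (h , snoc h e e≢e₀ (inj₁ (≡.refl , ≡.refl)))
    ... | inj₂ h = inj₂ (h , snoc h e e≢e₀ (inj₁ (≡.refl , ≡.refl)))

    piecewise : ∀ {x} {X : Set x} → (Fin n → X) → (Fin n → X) → Fin n → X
    piecewise f g v = [ (λ _ → f v) , (λ _ → g v) ]′ (side v)

    module Separated (bridge : IsBridge e₀) where
      A-B-disjoint : InA v → InB v → ⊥
      A-B-disjoint ha hb = bridge λ u w → reverse (from-a u) ◅◅ from-a w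
        where
          from-a : ∀ v → InA v
          from-a v = [ id , (ha ◅◅ reverse hb) ◅◅_ ]′ (side v)

      piecewise-A : ∀ {x} {X : Set x} (f g : Fin n → X) → InA v → piecewise f g v ≡ f v
      piecewise-A {v = v} f g ha = on (side v)
        where
          on : (s : Side v) → [ (λ _ → f v) , (λ _ → g v) ]′ s ≡ f v
          on (inj₁ _)  = ≡.refl
          on (inj₂ hb) = ⊥-elim (A-B-disjoint ha hb)

      piecewise-B : ∀ {x} {X : Set x} (f g : Fin n → X) → InB v → piecewise f g v ≡ g v
      piecewise-B {v = v} f g hb = on (side v)
        where
          on : (s : Side v) → [ (λ _ → f v) , (λ _ → g v) ]′ s ≡ g v
          on (inj₁ ha) = ⊥-elim (A-B-disjoint ha hb)
          on (inj₂ _)  = ≡.refl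

module RingIdentities {c ℓ} (R : CommutativeRing c ℓ) where
  open CommutativeRing R
  open AbelianGroupProperties +-abelianGroup using (ε⁻¹≈ε; ⁻¹-anti-homo‿-)
  open RingProperties ring using (-‿distribˡ-*)
  open SetoidReasoning setoid
  private
    module NR = NonReflective (ACR.fromCommutativeRing R (λ _ → nothing))
    open NR using (_⊕_; ⊝_; _⊜_)

  [x+y]-[z+w]≈[x-z]+[y-w] : ∀ x y z w → (x + y) - (z + w) ≈ (x - z) + (y - w)
  [x+y]-[z+w]≈[x-z]+[y-w] =
    NR.solve 4 (λ x y z w → ((x ⊕ y) ⊕ (⊝ (z ⊕ w))) ⊜ ((x ⊕ (⊝ z)) ⊕ (y ⊕ (⊝ w)))) refl

  [k+x]-[k+y]≈x-y : ∀ k x y → (k + x) - (k + y) ≈ x - y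
  [k+x]-[k+y]≈x-y k x y = begin
    (k + x) - (k + y)      ≈⟨ [x+y]-[z+w]≈[x-z]+[y-w] k x k y ⟩
    (k - k) + (x - y)      ≈⟨ +-congʳ (-‿inverseʳ k) ⟩
    0# + (x - y)           ≈⟨ +-identityˡ _ ⟩
    x - y                  ∎

  [x-z]-[y-z]≈x-y : ∀ x y z → (x - z) - (y - z) ≈ x - y
  [x-z]-[y-z]≈x-y x y z = begin
    (x - z) - (y - z)      ≈⟨ +-cong (+-comm x (- z)) (-‿cong (+-comm y (- z))) ⟩
    (- z + x) - (- z + y)  ≈⟨ [k+x]-[k+y]≈x-y (- z) x y ⟩
    x - y                  ∎

  [[k+x]+y]-[k+z]≈x+[y-z] : ∀ k x y z → ((k + x) + y) - (k + z) ≈ x + (y - z)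
  [[k+x]+y]-[k+z]≈x+[y-z] k x y z = begin
    ((k + x) + y) - (k + z)  ≈⟨ +-congʳ (+-assoc k x y) ⟩
    (k + (x + y)) - (k + z)  ≈⟨ [k+x]-[k+y]≈x-y k (x + y) z ⟩
    (x + y) - z              ≈⟨ +-assoc x y (- z) ⟩
    x + (y - z)              ∎

  x-z≈y-w⇒z≈w⇒x≈y : ∀ {x y z w} → x - z ≈ y - w → z ≈ w → x ≈ y
  x-z≈y-w⇒z≈w⇒x≈y {x} {y} {z} {w} x-z≈y-w z≈w = begin
    x             ≈⟨ [x-y]+y≈x x z ⟨
    (x - z) + z   ≈⟨ +-cong x-z≈y-w z≈w ⟩
    (y - w) + w   ≈⟨ [x-y]+y≈x y w ⟩
    y             ∎
    where
      [x-y]+y≈x : ∀ x y → (x - y) + y ≈ x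
      [x-y]+y≈x x y = trans (+-assoc x (- y) y) (trans (+-congˡ (-‿inverseˡ y)) (+-identityʳ x))

  x-y≈z*w⇒y-x≈[-z]*w : ∀ {x y z w} → x - y ≈ z * w → y - x ≈ (- z) * w
  x-y≈z*w⇒y-x≈[-z]*w {x} {y} {z} {w} x-y≈zw = begin
    y - x        ≈⟨ ⁻¹-anti-homo‿- x y ⟨
    - (x - y)    ≈⟨ -‿cong x-y≈zw ⟩
    - (z * w)    ≈⟨ -‿distribˡ-* z w ⟩
    (- z) * w    ∎

  y≈0⇒x-y≈x : ∀ {x y} → y ≈ 0# → x - y ≈ x
  y≈0⇒x-y≈x {x} y≈0 = trans (+-congˡ (trans (-‿cong y≈0) ε⁻¹≈ε)) (+-identityʳ x)

  x*[y*1]≈x*y : ∀ x y → x * (y * 1#) ≈ x * y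
  x*[y*1]≈x*y x y = *-congˡ (*-identityʳ y)

  x*[y*0]≈0 : ∀ x y → x * (y * 0#) ≈ 0#
  x*[y*0]≈0 x y = trans (*-congˡ (zeroʳ y)) (zeroʳ x)

module Decomposition {c ℓ i} (R : CommutativeRing c ℓ) (G : SimpleGraph)
    (α : Fin (SimpleGraph.m G) → Ideal R i) (e₀ : Fin (SimpleGraph.m G))
    (β : CommutativeRing.Carrier R)
    (connected : GraphNotions.Connected G (GraphNotions.allEdges G))
    (bridge : GraphNotions.IsBridge G e₀)
    (principal : IsPrincipalBy R (α e₀) β) where

  open CommutativeRing R
  open RingProperties ring using (-‿distribʳ-*; x[y-z]≈xy-xz)
  open AbelianGroupProperties +-abelianGroup using (⁻¹-∙-comm)
  open CommutativeSemigroupProperties *-commutativeSemigroup using (x∙yz≈y∙xz)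
  open RingIdentities R
  open GraphNotions G
  open BridgeSides G e₀
  open Components connected
  open Separated bridge
  open Splines R G α e₀ using (IsSpline; IsSplineOnVanishing; S-G; S-comp; DirectSum)
  open SetoidReasoning setoid
  module S = RawLeftModule S-G
  module D = RawLeftModule (DirectSum β)
  open LeftModuleMorphisms S-G (DirectSum β)

  private
    variable
      v : Fin n

  _∈_ : Carrier → Fin m → Set i
  x ∈ e = Ideal._∈I (α e) x

  ∈-resp : ∀ {e x y} → x ≈ y → x ∈ e → y ∈ e
  ∈-resp {e} = Ideal.∈-resp (α e)

  𝟙ᴮ : Fin n → Carrier
  𝟙ᴮ = piecewise (λ _ → 0#) (λ _ → 1#)

  𝟙ᴮ*x≈0 : InA v → ∀ x → 𝟙ᴮ v * x ≈ 0#
  𝟙ᴮ*x≈0 ha x = trans (*-congʳ (reflexive (piecewise-A (λ _ → 0#) (λ _ → 1#) ha))) (zeroˡ x)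

  𝟙ᴮ*x≈x : InB v → ∀ x → 𝟙ᴮ v * x ≈ x
  𝟙ᴮ*x≈x hb x = trans (*-congʳ (reflexive (piecewise-B (λ _ → 0#) (λ _ → 1#) hb))) (*-identityˡ x)

  𝟙ᴮ*-∈⟨β𝟙ᴮ⟩ : ∀ {x r} → x ≈ r * β →
                 (∀ v → InB v → 𝟙ᴮ v * x ≈ r * (β * 1#)) × (∀ v → InA v → 𝟙ᴮ v * x ≈ r * (β * 0#))
  𝟙ᴮ*-∈⟨β𝟙ᴮ⟩ {x} {r} x≈rβ =
      (λ v hb → trans (𝟙ᴮ*x≈x hb x) (trans x≈rβ (sym (x*[y*1]≈x*y r β))))
    , (λ v ha → trans (𝟙ᴮ*x≈0 ha x) (sym (x*[y*0]≈0 r β)))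

  ∈⟨β𝟙ᴮ⟩⇒≈𝟙ᴮ* : ∀ {y : Fin n → Carrier} {r} →
                 (∀ v → InB v → y v ≈ r * (β * 1#)) → (∀ v → InA v → y v ≈ r * (β * 0#)) →
                 ∀ v → y v ≈ 𝟙ᴮ v * (r * β)
  ∈⟨β𝟙ᴮ⟩⇒≈𝟙ᴮ* {r = r} on-B on-A v =
    [ (λ ha → trans (on-A v ha) (trans (x*[y*0]≈0 r β) (sym (𝟙ᴮ*x≈0 ha (r * β)))))
    , (λ hb → trans (on-B v hb) (trans (x*[y*1]≈x*y r β) (sym (𝟙ᴮ*x≈x hb (r * β))))) ]′
    (side v)

  jump : S.Carrierᴹ → Carrier
  jump (p , _) = p b - p a

  jump∈⟨β⟩ : ∀ p → ∃ λ r → jump p ≈ r * β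
  jump∈⟨β⟩ (p , spline) with proj₁ (principal _) (spline e₀)
  ... | r , pa-pb≈rβ = - r , x-y≈z*w⇒y-x≈[-z]*w pa-pb≈rβ

  relativeTo : (C : Fin n → Set) (z : Fin n) → S.Carrierᴹ → RawLeftModule.Carrierᴹ (S-comp C z)
  relativeTo C z (p , spline) =
      (λ v → p v - p z)
    , (λ e _ _ _ → ∈-resp (sym ([x-z]-[y-z]≈x-y _ _ _)) (spline e))
    , -‿inverseʳ (p z)

  decompose : S.Carrierᴹ → D.Carrierᴹ
  decompose p =
      relativeTo InA a p
    , relativeTo InB b p
    , ((λ _ → proj₁ p a) , proj₁ p a , λ _ → sym (*-identityʳ _))
    , ((λ v → 𝟙ᴮ v * jump p) , proj₁ (jump∈⟨β⟩ p) , 𝟙ᴮ*-∈⟨β𝟙ᴮ⟩ (proj₂ (jump∈⟨β⟩ p)))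

  decompose-cong : ∀ {p q} → p S.≈ᴹ q → decompose p D.≈ᴹ decompose q
  decompose-cong {p , _} {q , _} p≈q =
    (λ v _ → diff v a) , (λ v _ → diff v b) , (λ _ → p≈q a) , (λ v → *-congˡ (diff b a))
    where
      diff : ∀ x y → p x - p y ≈ q x - q y
      diff x y = +-cong (p≈q x) (-‿cong (p≈q y))

  decompose-+ : ∀ p q → decompose (p S.+ᴹ q) D.≈ᴹ (decompose p D.+ᴹ decompose q)
  decompose-+ (p , _) (q , _) =
      (λ v _ → diff v a) , (λ v _ → diff v b) , (λ _ → refl)
    , (λ v → trans (*-congˡ (diff b a)) (distribˡ (𝟙ᴮ v) _ _))
    where
      diff : ∀ x y → (p x + q x) - (p y + q y) ≈ (p x - p y) + (q x - q y)
      diff x y = [x+y]-[z+w]≈[x-z]+[y-w] (p x) (q x) (p y) (q y)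

  decompose-0 : decompose S.0ᴹ D.≈ᴹ D.0ᴹ
  decompose-0 =
      (λ _ _ → -‿inverseʳ 0#) , (λ _ _ → -‿inverseʳ 0#) , (λ _ → refl)
    , (λ v → trans (*-congˡ (-‿inverseʳ 0#)) (zeroʳ (𝟙ᴮ v)))

  decompose-‿ : ∀ p → decompose (S.-ᴹ p) D.≈ᴹ D.-ᴹ decompose p
  decompose-‿ (p , _) =
      (λ v _ → diff v a) , (λ v _ → diff v b) , (λ _ → refl)
    , (λ v → trans (*-congˡ (diff b a)) (sym (-‿distribʳ-* (𝟙ᴮ v) _)))
    where
      diff : ∀ x y → (- p x) - (- p y) ≈ - (p x - p y)
      diff x y = ⁻¹-∙-comm (p x) (- p y)

  decompose-* : ∀ r p → decompose (r S.*ₗ p) D.≈ᴹ r D.*ₗ decompose p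
  decompose-* r (p , _) =
      (λ v _ → diff v a) , (λ v _ → diff v b) , (λ _ → refl)
    , (λ v → trans (*-congˡ (diff b a)) (x∙yz≈y∙xz (𝟙ᴮ v) r _))
    where
      diff : ∀ x y → r * p x - r * p y ≈ r * (p x - p y)
      diff x y = sym (x[y-z]≈xy-xz r (p x) (p y))

  decompose-injective : ∀ {p q} → decompose p D.≈ᴹ decompose q → p S.≈ᴹ q
  decompose-injective {p , _} {q , _} (onA , onB , constant , jumps) v =
    [ (λ ha → x-z≈y-w⇒z≈w⇒x≈y (onA v ha) pa≈qa)
    , (λ hb → x-z≈y-w⇒z≈w⇒x≈y (onB v hb) pb≈qb) ]′ (side v)
    where
      pa≈qa : p a ≈ q a
      pa≈qa = constant a

      pb≈qb : p b ≈ q b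
      pb≈qb = x-z≈y-w⇒z≈w⇒x≈y (trans (sym (𝟙ᴮ*x≈x here _)) (trans (jumps b) (𝟙ᴮ*x≈x here _))) pa≈qa

  module Assembly (qA : Fin n → Carrier) (qA-spline : IsSplineOnVanishing InA a qA)
                  (qB : Fin n → Carrier) (qB-spline : IsSplineOnVanishing InB b qB)
                  (κ r : Carrier) where

    qA-a≈0 : qA a ≈ 0#
    qA-a≈0 = proj₂ qA-spline

    qB-b≈0 : qB b ≈ 0#
    qB-b≈0 = proj₂ qB-spline

    P : Fin n → Carrier
    P = piecewise (λ v → κ + qA v) (λ v → (κ + r * β) + qB v)

    P-A : ∀ {v} → InA v → P v ≈ κ + qA v
    P-A = reflexive ∘ piecewise-A (λ v → κ + qA v) (λ v → (κ + r * β) + qB v)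

    P-B : ∀ {v} → InB v → P v ≈ (κ + r * β) + qB v
    P-B = reflexive ∘ piecewise-B (λ v → κ + qA v) (λ v → (κ + r * β) + qB v)

    P-diff-A : ∀ {u w} → InA u → InA w → P u - P w ≈ qA u - qA w
    P-diff-A hu hw = trans (+-cong (P-A hu) (-‿cong (P-A hw))) ([k+x]-[k+y]≈x-y _ _ _)

    P-diff-B : ∀ {u w} → InB u → InB w → P u - P w ≈ qB u - qB w
    P-diff-B hu hw = trans (+-cong (P-B hu) (-‿cong (P-B hw))) ([k+x]-[k+y]≈x-y _ _ _)

    P-a : P a ≈ κ
    P-a = trans (P-A here) (trans (+-congˡ qA-a≈0) (+-identityʳ κ))

    P-jump : P b - P a ≈ r * β
    P-jump = begin
      P b - P a                              ≈⟨ +-cong (P-B here) (-‿cong (P-A here)) ⟩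
      ((κ + r * β) + qB b) - (κ + qA a)      ≈⟨ [[k+x]+y]-[k+z]≈x+[y-z] κ (r * β) (qB b) (qA a) ⟩
      r * β + (qB b - qA a)                  ≈⟨ +-congˡ (+-cong qB-b≈0 (-‿cong qA-a≈0)) ⟩
      r * β + (0# - 0#)                      ≈⟨ +-congˡ (-‿inverseʳ 0#) ⟩
      r * β + 0#                             ≈⟨ +-identityʳ _ ⟩
      r * β                                  ∎

    P-spline : IsSpline P
    P-spline e with e ≟ e₀
    ... | yes ≡.refl = proj₂ (principal _) (- r , x-y≈z*w⇒y-x≈[-z]*w P-jump)
    ... | no e≢e₀ =
      [ (λ (hs , ht) → ∈-resp (sym (P-diff-A hs ht)) (proj₁ qA-spline e e≢e₀ hs ht))
      , (λ (hs , ht) → ∈-resp (sym (P-diff-B hs ht)) (proj₁ qB-spline e e≢e₀ hs ht)) ]′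
      (edge-within-side e≢e₀)

  assemble : D.Carrierᴹ → S.Carrierᴹ
  assemble ((qA , qA-spline) , (qB , qB-spline) , (_ , κ , _) , (_ , r , _)) =
    P , P-spline
    where open Assembly qA qA-spline qB qB-spline κ r

  decompose-assemble : ∀ t → decompose (assemble t) D.≈ᴹ t
  decompose-assemble ((qA , qA-spline) , (qB , qB-spline) , (_ , κ , k≈κ) , (_ , r , y-B , y-A)) =
      (λ v ha → trans (P-diff-A ha here) (y≈0⇒x-y≈x qA-a≈0))
    , (λ v hb → trans (P-diff-B hb here) (y≈0⇒x-y≈x qB-b≈0))
    , (λ v → trans P-a (sym (trans (k≈κ v) (*-identityʳ κ))))
    , (λ v → trans (*-congˡ P-jump) (sym (∈⟨β𝟙ᴮ⟩⇒≈𝟙ᴮ* y-B y-A v)))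
    where open Assembly qA qA-spline qB qB-spline κ r

  ≈ᴰ-trans : ∀ {s t u} → s D.≈ᴹ t → t D.≈ᴹ u → s D.≈ᴹ u
  ≈ᴰ-trans (s₁ , s₂ , s₃ , s₄) (t₁ , t₂ , t₃ , t₄) =
      (λ v h → trans (s₁ v h) (t₁ v h)) , (λ v h → trans (s₂ v h) (t₂ v h))
    , (λ v → trans (s₃ v) (t₃ v)) , (λ v → trans (s₄ v) (t₄ v))

  decompose-isomorphism : IsLeftModuleIsomorphism decompose
  decompose-isomorphism = record
    { isLeftModuleMonomorphism = record
      { isLeftModuleHomomorphism = record
        { +ᴹ-isGroupHomomorphism = record
          { isMonoidHomomorphism = record
            { isMagmaHomomorphism = record
              { isRelHomomorphism = record { cong = λ {p} {q} → decompose-cong {p} {q} }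
              ; homo = decompose-+ }
            ; ε-homo = decompose-0 }
          ; ⁻¹-homo = decompose-‿ }
        ; *ₗ-homo = decompose-* }
      ; injective = λ {p} {q} → decompose-injective {p} {q} }
    ; surjective = λ t → assemble t , λ {z} z≈ →
        ≈ᴰ-trans {decompose z} {decompose (assemble t)} {t}
                 (decompose-cong {z} {assemble t} z≈) (decompose-assemble t) }

corollary2p7 : ∀ {c ℓ i} (R : CommutativeRing c ℓ) (G : SimpleGraph)
    (α : Fin (SimpleGraph.m G) → Ideal R i) (e₀ : Fin (SimpleGraph.m G))
    (β : CommutativeRing.Carrier R) →
    GraphNotions.Connected G (GraphNotions.allEdges G) →
    GraphNotions.IsBridge G e₀ →
    IsPrincipalBy R (α e₀) β →
    ∃ λ f → LeftModuleMorphisms.IsLeftModuleIsomorphism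
              (Splines.S-G R G α e₀) (Splines.DirectSum R G α e₀ β) f
corollary2p7 R G α e₀ β connected bridge principal = decompose , decompose-isomorphism
  where open Decomposition R G α e₀ β connected bridge principal
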